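{- Let $\mathfrak p(X,Y)$ be a nice or co-nice polynomial with leading coefficient $a$. Then either $\mathfrak p$ is constant, and thus $\mathfrak p(m,n)=a$ for all $m,n\in\mathbb N$, or there is an $n_0\in\mathbb N$ such that for all $n\ge n_0$, \[\operatorname{sign}(\mathfrak p(n-1,n))=\operatorname{sign}(\mathfrak p(n+1,n))=\operatorname{sign}(a)\] and \[|\mathfrak p(n-1,n)|\ge\frac{|a|}{2}n,\qquad |\mathfrak p(n+1,n)|\ge\frac{|a|}{2}n.\]
   Context: A polynomial $\mathfrak p(X,Y)$ is nice if it is of the form $\mathfrak p(X,Y)=\sum_{i=0}^k a_iX^{\lfloor i/2\rfloor}Y^{\lceil i/2\rceil}$ for some $k\in\mathbb N$ and real coefficients $a_i$; its leading coefficient is $a_i$ for the maximum $i$ with $a_i\ne0$, or $0$ if all $a_i=0$. A polynomial $\mathfrak p(X,Y)$ is co-nice if $\mathfrak p(Y,X)$ is nice (its leading coefficient being that of the nice polynomial $\mathfrak p(Y,X)$). $\operatorname{sign}(r)$ is $-1,0,1$ according as $r<0$, $r=0$, $r>0$. -}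

module Defs where

open import Level using (Level; _⊔_) renaming (suc to lsuc)
open import Algebra.Bundles using (CommutativeRing)
open import Algebra.Structures using (IsCommutativeRing)
open import Relation.Binary.Core using (Rel)
open import Relation.Binary.Structures using (IsStrictTotalOrder)
open import Relation.Binary.Definitions using (tri<; tri≈; tri>)
open import Relation.Nullary using (¬_)
open import Data.Nat as ℕ using (ℕ; zero; suc; ⌊_/2⌋; ⌈_/2⌉)
open import Data.Integer as ℤ using (ℤ; +_; -[1+_])
open import Data.List using (List; []; _∷_)
open import Data.Product using (∃; _×_)
open import Data.Sum using (_⊎_)

embedℕ : ∀ {c} {A : Set c} → A → A → (A → A → A) → ℕ → A
embedℕ z o _+_ zero = z
embedℕ z o _+_ (suc n) = o + embedℕ z o _+_ n

-- An Archimedean ordered field (ℝ is the intended instance; the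
-- standard library has no real numbers).
record ArchimedeanOrderedField c ℓ r : Set (lsuc (c ⊔ ℓ ⊔ r)) where
  infix 4 _<_
  field
    Carrier : Set c
    _≈_ : Rel Carrier ℓ
    _+_ _*_ : Carrier → Carrier → Carrier
    -_ : Carrier → Carrier
    0# 1# : Carrier
    isCommutativeRing : IsCommutativeRing _≈_ _+_ _*_ -_ 0# 1#
    _<_ : Rel Carrier r
    <-isStrictTotalOrder : IsStrictTotalOrder _≈_ _<_
    +-monoˡ-< : ∀ {x y} z → x < y → (x + z) < (y + z)
    *-pos : ∀ {x y} → 0# < x → 0# < y → 0# < (x * y)
    0<1 : 0# < 1#
    inverse : ∀ x → ¬ (x ≈ 0#) → ∃ λ y → (x * y) ≈ 1#
    archimedean : ∀ x → ∃ λ (n : ℕ) → x < embedℕ 0# 1# _+_ n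

  open IsStrictTotalOrder <-isStrictTotalOrder public using (compare)

  infix 4 _≤_
  _≤_ : Carrier → Carrier → Set (ℓ ⊔ r)
  x ≤ y = (x < y) ⊎ (x ≈ y)

  _-_ : Carrier → Carrier → Carrier
  x - y = x + (- y)

  fromℕ : ℕ → Carrier
  fromℕ = embedℕ 0# 1# _+_

  pow : Carrier → ℕ → Carrier
  pow x zero = 1#
  pow x (suc n) = x * pow x n

  sign : Carrier → ℤ
  sign x with compare x 0#
  ... | tri< _ _ _ = -[1+ 0 ]
  ... | tri≈ _ _ _ = + 0
  ... | tri> _ _ _ = + 1

  ∣_∣ : Carrier → Carrier
  ∣ x ∣ with compare x 0#
  ... | tri< _ _ _ = - x
  ... | tri≈ _ _ _ = x
  ... | tri> _ _ _ = x

  -- A nice polynomial Σ_{i=0}^k a_i X^⌊i/2⌋ Y^⌈i/2⌉ is represented by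
  -- its coefficient list a_0 ∷ a_1 ∷ … ∷ a_k ∷ [].
  -- Evaluation starting at index i:
  niceEvalFrom : ℕ → List Carrier → Carrier → Carrier → Carrier
  niceEvalFrom i [] x y = 0#
  niceEvalFrom i (a ∷ as) x y =
    (a * (pow x ⌊ i /2⌋ * pow y ⌈ i /2⌉)) + niceEvalFrom (suc i) as x y

  niceEval : List Carrier → Carrier → Carrier → Carrier
  niceEval = niceEvalFrom 0

  -- leading coefficient: a_i for the maximal i with a_i ≠ 0, or 0.
  leading : List Carrier → Carrier
  leading [] = 0#
  leading (a ∷ as) with compare (leading as) 0#
  ... | tri≈ _ _ _ = a
  ... | tri< _ _ _ = leading as
  ... | tri> _ _ _ = leading as

  data AllZero : List Carrier → Set (c ⊔ ℓ) where
    []  : AllZero []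
    _∷_ : ∀ {a as} → a ≈ 0# → AllZero as → AllZero (a ∷ as)

  IsConstant : List Carrier → Set (c ⊔ ℓ)
  IsConstant [] = Level.Lift _ Data.Unit.⊤ where import Data.Unit
  IsConstant (a ∷ as) = AllZero as

data Kind : Set where
  nice conice : Kind

module _ {c ℓ r} (F : ArchimedeanOrderedField c ℓ r) where
  open ArchimedeanOrderedField F

  -- p(X,Y) where p is nice with coefficients as, or co-nice, i.e.
  -- p(Y,X) is the nice polynomial with coefficients as.
  eval : Kind → List Carrier → Carrier → Carrier → Carrier
  eval nice   as x y = niceEval as x y
  eval conice as x y = niceEval as y x

{-# OPTIONS --safe #-}
module Submission where

-- Unfolding one step, p(x, y) = a₀ + y · q(y, x), where q is the nice polynomial
-- with coefficients a₁, a₂, …; so nice and co-nice polynomials obey the same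
-- Horner scheme.  Let s = ±1 be the sign of the leading coefficient a and A = s · a.
-- By Archimedes, s · aᵢ ≥ -M · A for all coefficients and some M ∈ ℕ.  If x, y ≥ 1 + M,
-- induction along the scheme gives s · q(y, x) ≥ A, hence s · p(x, y) ≥ y · A - M · A.
-- At (n ∓ 1, n) and at the swapped points both coordinates are ≥ n - 1, so for
-- n ≥ 2M + 2 this yields 2 · s · p ≥ A · n > 0.

open import Defs
open import Level using (_⊔_; lift)
open import Algebra.Bundles using (CommutativeRing)
import Algebra.Properties.AbelianGroup as AbelianGroupProperties
import Algebra.Properties.Group as GroupProperties
import Algebra.Properties.Ring as RingProperties
import Algebra.Solver.Ring.NaturalCoefficients.Default as NaturalCoefficientSolver
open import Data.Empty using (⊥-elim)
open import Data.Integer using (+_; -[1+_])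
open import Data.List using (List; []; _∷_; map)
open import Data.List.Relation.Unary.All as All using (All; []; _∷_)
open import Data.List.Relation.Unary.All.Properties using (map⁻)
open import Data.Nat as ℕ using (ℕ; zero; suc; _≥_; z≤n; s≤s; ⌊_/2⌋; ⌈_/2⌉)
import Data.Nat.Properties as ℕ
open import Data.Product using (∃; _×_; _,_)
open import Data.Sum using (_⊎_; inj₁; inj₂)
open import Data.Unit using (tt)
open import Relation.Binary.Bundles using (StrictTotalOrder)
open import Relation.Binary.Definitions using (tri<; tri≈; tri>)
import Relation.Binary.Properties.StrictPartialOrder as StrictPartialOrderProperties
import Relation.Binary.Reasoning.StrictPartialOrder as StrictPartialOrderReasoning
open import Relation.Binary.PropositionalEquality using (_≡_; refl; trans; sym)

module _ {c ℓ r} (F : ArchimedeanOrderedField c ℓ r) where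

  open ArchimedeanOrderedField F hiding (_≈_; _+_; _*_; -_; _-_)

  commutativeRing : CommutativeRing c ℓ
  commutativeRing = record { isCommutativeRing = isCommutativeRing }

  strictTotalOrder : StrictTotalOrder c ℓ r
  strictTotalOrder = record { isStrictTotalOrder = <-isStrictTotalOrder }

  open CommutativeRing commutativeRing
    using ( _≈_; _+_; _*_; -_; _-_; +-cong; +-congˡ; +-congʳ; *-congˡ; *-congʳ
          ; +-assoc; +-comm; *-comm; *-assoc; +-identityˡ; +-identityʳ; *-identityˡ; *-identityʳ
          ; zeroˡ; zeroʳ; distribˡ
          ; -‿inverseˡ; -‿inverseʳ; +-group; +-abelianGroup; ring; commutativeSemiring )
    renaming (refl to ≈-refl; sym to ≈-sym; trans to ≈-trans)
  open GroupProperties +-group using (\\-leftDividesʳ; //-rightDividesˡ)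
  open AbelianGroupProperties +-abelianGroup using (xyx⁻¹≈y)
  open RingProperties ring using (-1*x≈-x)
  open StrictTotalOrder strictTotalOrder
    using (irrefl; asym; <-respˡ-≈; <-respʳ-≈; strictPartialOrder)
  open StrictPartialOrderProperties strictPartialOrder
    using () renaming (reflexive to ≤-reflexive; trans to ≤-trans)
  open StrictPartialOrderReasoning strictPartialOrder
  open NaturalCoefficientSolver commutativeSemiring using (solve; _:=_; _:+_; _:*_; con)

  +-monoˡ-≤ : ∀ z {x y} → x ≤ y → x + z ≤ y + z
  +-monoˡ-≤ z (inj₁ x<y) = inj₁ (+-monoˡ-< z x<y)
  +-monoˡ-≤ z (inj₂ x≈y) = inj₂ (+-congʳ x≈y)

  +-monoʳ-≤ : ∀ z {x y} → x ≤ y → z + x ≤ z + y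
  +-monoʳ-≤ z {x} {y} x≤y = begin
    z + x  ≈⟨ +-comm z x ⟩
    x + z  ≤⟨ +-monoˡ-≤ z x≤y ⟩
    y + z  ≈⟨ +-comm y z ⟩
    z + y  ∎

  +-mono-≤ : ∀ {x y u v} → x ≤ y → u ≤ v → x + u ≤ y + v
  +-mono-≤ {y = y} {u} x≤y u≤v = ≤-trans (+-monoˡ-≤ u x≤y) (+-monoʳ-≤ y u≤v)

  +-cancelˡ-≤ : ∀ z {x y} → z + x ≤ z + y → x ≤ y
  +-cancelˡ-≤ z {x} {y} z+x≤z+y = begin
    x              ≈⟨ \\-leftDividesʳ z x ⟨
    - z + (z + x)  ≤⟨ +-monoʳ-≤ (- z) z+x≤z+y ⟩
    - z + (z + y)  ≈⟨ \\-leftDividesʳ z y ⟩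
    y              ∎

  x≤y+x : ∀ {x y} → 0# ≤ y → x ≤ y + x
  x≤y+x {x} {y} 0≤y = begin
    x       ≈⟨ +-identityˡ x ⟨
    0# + x  ≤⟨ +-monoˡ-≤ x 0≤y ⟩
    y + x   ∎

  x≤x+y : ∀ {x y} → 0# ≤ y → x ≤ x + y
  x≤x+y {x} {y} 0≤y = ≤-trans (x≤y+x 0≤y) (≤-reflexive (+-comm y x))

  0≤1+x : ∀ {x} → 0# ≤ x → 0# ≤ 1# + x
  0≤1+x 0≤x = ≤-trans 0≤x (x≤y+x (inj₁ 0<1))

  *-monoˡ-< : ∀ {z x y} → 0# < z → x < y → z * x < z * y
  *-monoˡ-< {z} {x} {y} 0<z x<y = begin-strict
    z * x                ≈⟨ +-identityˡ (z * x) ⟨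
    0# + z * x           <⟨ +-monoˡ-< (z * x) (*-pos 0<z 0<y-x) ⟩
    z * (y - x) + z * x  ≈⟨ distribˡ z (y - x) x ⟨
    z * (y - x + x)      ≈⟨ *-congˡ (//-rightDividesˡ x y) ⟩
    z * y                ∎
    where
    0<y-x : 0# < y - x
    0<y-x = <-respˡ-≈ (-‿inverseʳ x) (+-monoˡ-< (- x) x<y)

  *-monoʳ-< : ∀ {z x y} → 0# < z → x < y → x * z < y * z
  *-monoʳ-< {z} {x} {y} 0<z x<y =
    <-respˡ-≈ (*-comm z x) (<-respʳ-≈ (*-comm z y) (*-monoˡ-< 0<z x<y))

  *-monoˡ-≤ : ∀ {z x y} → 0# ≤ z → x ≤ y → z * x ≤ z * y
  *-monoˡ-≤ (inj₁ 0<z) (inj₁ x<y) = inj₁ (*-monoˡ-< 0<z x<y)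
  *-monoˡ-≤ (inj₁ 0<z) (inj₂ x≈y) = inj₂ (*-congˡ x≈y)
  *-monoˡ-≤ {z} {x} {y} (inj₂ 0≈z) _ = ≤-reflexive (begin-equality
    z * x   ≈⟨ *-congʳ 0≈z ⟨
    0# * x  ≈⟨ zeroˡ x ⟩
    0#      ≈⟨ zeroˡ y ⟨
    0# * y  ≈⟨ *-congʳ 0≈z ⟩
    z * y   ∎)

  *-monoʳ-≤ : ∀ {z x y} → 0# ≤ z → x ≤ y → x * z ≤ y * z
  *-monoʳ-≤ {z} {x} {y} 0≤z x≤y = begin
    x * z  ≈⟨ *-comm x z ⟩
    z * x  ≤⟨ *-monoˡ-≤ 0≤z x≤y ⟩
    z * y  ≈⟨ *-comm z y ⟩
    y * z  ∎

  x<0⇒0<-x : ∀ {x} → x < 0# → 0# < - x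
  x<0⇒0<-x {x} x<0 = <-respˡ-≈ (-‿inverseʳ x) (<-respʳ-≈ (+-identityˡ (- x)) (+-monoˡ-< (- x) x<0))

  0<-x⇒x<0 : ∀ {x} → 0# < - x → x < 0#
  0<-x⇒x<0 {x} 0<-x = <-respˡ-≈ (+-identityˡ x) (<-respʳ-≈ (-‿inverseˡ x) (+-monoˡ-< x 0<-x))

  fromℕ-+ : ∀ m n → fromℕ (m ℕ.+ n) ≈ fromℕ m + fromℕ n
  fromℕ-+ zero    n = ≈-sym (+-identityˡ (fromℕ n))
  fromℕ-+ (suc m) n = ≈-trans (+-congˡ (fromℕ-+ m n)) (≈-sym (+-assoc 1# (fromℕ m) (fromℕ n)))

  0≤fromℕ : ∀ n → 0# ≤ fromℕ n
  0≤fromℕ zero    = inj₂ ≈-refl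
  0≤fromℕ (suc n) = 0≤1+x (0≤fromℕ n)

  fromℕ-mono-≤ : ∀ {m n} → m ℕ.≤ n → fromℕ m ≤ fromℕ n
  fromℕ-mono-≤ {n = n} z≤n = 0≤fromℕ n
  fromℕ-mono-≤ (s≤s m≤n)   = +-monoʳ-≤ 1# (fromℕ-mono-≤ m≤n)

  archimedean-lowerBound : ∀ {A} → 0# < A → ∀ v → ∃ λ M → 0# ≤ fromℕ M * A + v
  archimedean-lowerBound {A} 0<A v with inverse A (λ A≈0 → irrefl (≈-sym A≈0) 0<A)
  ... | A⁻¹ , A*A⁻¹≈1 with archimedean (- v * A⁻¹)
  ... | M , -v/A<M = M , inj₁ (begin-strict
    0#                   ≈⟨ -‿inverseˡ v ⟨
    - v + v              ≈⟨ +-congʳ -v/A*A≈-v ⟨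
    - v * A⁻¹ * A + v    <⟨ +-monoˡ-< v (*-monoʳ-< 0<A -v/A<M) ⟩
    fromℕ M * A + v      ∎)
    where
    -v/A*A≈-v : - v * A⁻¹ * A ≈ - v
    -v/A*A≈-v = begin-equality
      - v * A⁻¹ * A    ≈⟨ *-assoc (- v) A⁻¹ A ⟩
      - v * (A⁻¹ * A)  ≈⟨ *-congˡ (≈-trans (*-comm A⁻¹ A) A*A⁻¹≈1) ⟩
      - v * 1#         ≈⟨ *-identityʳ (- v) ⟩
      - v              ∎

  archimedean-lowerBound-All : ∀ {A} → 0# < A → ∀ vs → ∃ λ M → All (λ v → 0# ≤ fromℕ M * A + v) vs
  archimedean-lowerBound-All 0<A [] = 0 , []
  archimedean-lowerBound-All {A} 0<A (v ∷ vs)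
    with archimedean-lowerBound 0<A v | archimedean-lowerBound-All 0<A vs
  ... | M₁ , h₁ | M₂ , h₂ =
    M₁ ℕ.+ M₂ , raise (ℕ.m≤m+n M₁ M₂) h₁ ∷ All.map (raise (ℕ.m≤n+m M₂ M₁)) h₂
    where
    raise : ∀ {M M′ v} → M ℕ.≤ M′ → 0# ≤ fromℕ M * A + v → 0# ≤ fromℕ M′ * A + v
    raise M≤M′ h = ≤-trans h (+-monoˡ-≤ _ (*-monoʳ-≤ (inj₁ 0<A) (fromℕ-mono-≤ M≤M′)))

  data IsSignOf : Carrier → Carrier → Set (c ⊔ r) where
    positive : ∀ {x} → 0# < x → IsSignOf 1# x
    negative : ∀ {x} → x < 0# → IsSignOf (- 1#) x

  IsSignOf⇒0<s*x : ∀ {s x} → IsSignOf s x → 0# < s * x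
  IsSignOf⇒0<s*x {x = x} (positive 0<x) = <-respʳ-≈ (≈-sym (*-identityˡ x)) 0<x
  IsSignOf⇒0<s*x {x = x} (negative x<0) = <-respʳ-≈ (≈-sym (-1*x≈-x x)) (x<0⇒0<-x x<0)

  IsSignOf-transfer : ∀ {s x y} → IsSignOf s x → 0# < s * y → IsSignOf s y
  IsSignOf-transfer {y = y} (positive _) 0<s*y = positive (<-respʳ-≈ (*-identityˡ y) 0<s*y)
  IsSignOf-transfer {y = y} (negative _) 0<s*y = negative (0<-x⇒x<0 (<-respʳ-≈ (-1*x≈-x y) 0<s*y))

  sign-positive : ∀ {x} → 0# < x → sign x ≡ + 1
  sign-positive {x} 0<x with compare x 0#
  ... | tri< x<0 _ _ = ⊥-elim (asym x<0 0<x)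
  ... | tri≈ _ x≈0 _ = ⊥-elim (irrefl (≈-sym x≈0) 0<x)
  ... | tri> _ _ _   = refl

  sign-negative : ∀ {x} → x < 0# → sign x ≡ -[1+ 0 ]
  sign-negative {x} x<0 with compare x 0#
  ... | tri< _ _ _   = refl
  ... | tri≈ _ x≈0 _ = ⊥-elim (irrefl x≈0 x<0)
  ... | tri> _ _ 0<x = ⊥-elim (asym x<0 0<x)

  ∣x∣≈x : ∀ {x} → 0# < x → ∣ x ∣ ≈ x
  ∣x∣≈x {x} 0<x with compare x 0#
  ... | tri< x<0 _ _ = ⊥-elim (asym x<0 0<x)
  ... | tri≈ _ _ _   = ≈-refl
  ... | tri> _ _ _   = ≈-refl

  ∣x∣≈-x : ∀ {x} → x < 0# → ∣ x ∣ ≈ - x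
  ∣x∣≈-x {x} x<0 with compare x 0#
  ... | tri< _ _ _   = ≈-refl
  ... | tri≈ _ x≈0 _ = ⊥-elim (irrefl x≈0 x<0)
  ... | tri> _ _ 0<x = ⊥-elim (asym x<0 0<x)

  IsSignOf-sign : ∀ {s x y} → IsSignOf s x → 0# < s * y → sign y ≡ sign x
  IsSignOf-sign {y = y} (positive 0<x) 0<s*y =
    trans (sign-positive (<-respʳ-≈ (*-identityˡ y) 0<s*y)) (sym (sign-positive 0<x))
  IsSignOf-sign {y = y} (negative x<0) 0<s*y =
    trans (sign-negative (0<-x⇒x<0 (<-respʳ-≈ (-1*x≈-x y) 0<s*y))) (sym (sign-negative x<0))

  IsSignOf-∣∣ : ∀ {s x} → IsSignOf s x → ∣ x ∣ ≈ s * x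
  IsSignOf-∣∣ {x = x} (positive 0<x) = ≈-trans (∣x∣≈x 0<x) (≈-sym (*-identityˡ x))
  IsSignOf-∣∣ {x = x} (negative x<0) = ≈-trans (∣x∣≈-x x<0) (≈-sym (-1*x≈-x x))

  niceEvalFrom-suc : ∀ i bs x y → niceEvalFrom (suc i) bs x y ≈ y * niceEvalFrom i bs y x
  niceEvalFrom-suc i []       x y = ≈-sym (zeroʳ y)
  -- ⌊ suc i /2⌋ = ⌈ i /2⌉ and ⌈ suc i /2⌉ = suc ⌊ i /2⌋ hold by computation.
  niceEvalFrom-suc i (b ∷ bs) x y = begin-equality
    b * (X * (y * Y)) + niceEvalFrom (suc (suc i)) bs x y
      ≈⟨ +-congˡ (niceEvalFrom-suc (suc i) bs x y) ⟩
    b * (X * (y * Y)) + y * niceEvalFrom (suc i) bs y x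
      ≈⟨ regroup b X y Y _ ⟩
    y * (b * (Y * X) + niceEvalFrom (suc i) bs y x)
      ∎
    where
    X = pow x ⌈ i /2⌉
    Y = pow y ⌊ i /2⌋
    regroup : ∀ b X y Y R → b * (X * (y * Y)) + y * R ≈ y * (b * (Y * X) + R)
    regroup = solve 5 (λ b X y Y R → b :* (X :* (y :* Y)) :+ y :* R
                                  := y :* (b :* (Y :* X) :+ R)) ≈-refl

  niceEval-cons : ∀ b bs x y → niceEval (b ∷ bs) x y ≈ b + y * niceEval bs y x
  niceEval-cons b bs x y =
    +-cong (≈-trans (*-congˡ (*-identityˡ 1#)) (*-identityʳ b)) (niceEvalFrom-suc 0 bs x y)

  AllZero⇒niceEval≈0 : ∀ {bs} → AllZero bs → ∀ x y → niceEval bs x y ≈ 0#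
  AllZero⇒niceEval≈0 []                          x y = ≈-refl
  AllZero⇒niceEval≈0 {b ∷ bs} (b≈0 ∷ bs-allZero) x y = begin-equality
    niceEval (b ∷ bs) x y    ≈⟨ niceEval-cons b bs x y ⟩
    b + y * niceEval bs y x  ≈⟨ +-cong b≈0 (*-congˡ (AllZero⇒niceEval≈0 bs-allZero y x)) ⟩
    0# + y * 0#              ≈⟨ +-identityˡ (y * 0#) ⟩
    y * 0#                   ≈⟨ zeroʳ y ⟩
    0#                       ∎

  niceEval-constant : ∀ {b bs} → AllZero bs → ∀ x y → niceEval (b ∷ bs) x y ≈ b
  niceEval-constant {b} {bs} bs-allZero x y = begin-equality
    niceEval (b ∷ bs) x y    ≈⟨ niceEval-cons b bs x y ⟩
    b + y * niceEval bs y x  ≈⟨ +-congˡ (*-congˡ (AllZero⇒niceEval≈0 bs-allZero y x)) ⟩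
    b + y * 0#               ≈⟨ +-congˡ (zeroʳ y) ⟩
    b + 0#                   ≈⟨ +-identityʳ b ⟩
    b                        ∎

  leading≈0⇒AllZero : ∀ bs → leading bs ≈ 0# → AllZero bs
  leading≈0⇒AllZero []       _ = []
  leading≈0⇒AllZero (b ∷ bs) leading≈0 with compare (leading bs) 0#
  ... | tri< _ ≉0 _ = ⊥-elim (≉0 leading≈0)
  ... | tri≈ _ ≈0 _ = leading≈0 ∷ leading≈0⇒AllZero bs ≈0
  ... | tri> _ ≉0 _ = ⊥-elim (≉0 leading≈0)

  eval-elim : ∀ {p} (P : Carrier → Set p) k bs {x y} →
              P (niceEval bs x y) → P (niceEval bs y x) → P (eval F k bs x y)
  eval-elim P nice   bs Pxy _   = Pxy
  eval-elim P conice bs _   Pyx = Pyx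

  niceEval-cons-linearBound : ∀ {s A m x y} b bs → 0# ≤ y → 0# ≤ m * A + s * b →
                             A ≤ s * niceEval bs y x → y * A ≤ m * A + s * niceEval (b ∷ bs) x y
  niceEval-cons-linearBound {s} {A} {m} {x} {y} b bs 0≤y b-bound A≤s*q = begin
    y * A                              ≈⟨ +-identityˡ (y * A) ⟨
    0# + y * A                         ≤⟨ +-mono-≤ b-bound (*-monoˡ-≤ 0≤y A≤s*q) ⟩
    m * A + s * b + y * (s * q)        ≈⟨ regroup m A s b y q ⟩
    m * A + s * (b + y * q)            ≈⟨ +-congˡ (*-congˡ (niceEval-cons b bs x y)) ⟨
    m * A + s * niceEval (b ∷ bs) x y  ∎
    where
    q : Carrier
    q = niceEval bs y x
    regroup : ∀ m A s b y q → m * A + s * b + y * (s * q) ≈ m * A + s * (b + y * q)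
    regroup = solve 6 (λ m A s b y q → m :* A :+ s :* b :+ y :* (s :* q)
                                    := m :* A :+ s :* (b :+ y :* q)) ≈-refl

  niceEval-cons-lowerBound : ∀ {s A m x y} b bs → 0# ≤ A → 0# ≤ m → 1# + m ≤ y →
                             0# ≤ m * A + s * b → A ≤ s * niceEval bs y x →
                             A ≤ s * niceEval (b ∷ bs) x y
  niceEval-cons-lowerBound {s} {A} {m} {x} {y} b bs 0≤A 0≤m 1+m≤y b-bound A≤s*q =
    +-cancelˡ-≤ (m * A) (begin
      m * A + A                          ≈⟨ regroup m A ⟩
      (1# + m) * A                       ≤⟨ *-monoʳ-≤ 0≤A 1+m≤y ⟩
      y * A                              ≤⟨ niceEval-cons-linearBound b bs 0≤y b-bound A≤s*q ⟩
      m * A + s * niceEval (b ∷ bs) x y  ∎)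
    where
    0≤y : 0# ≤ y
    0≤y = ≤-trans (0≤1+x 0≤m) 1+m≤y
    regroup : ∀ m A → m * A + A ≈ (1# + m) * A
    regroup = solve 2 (λ m A → m :* A :+ A := (con 1 :+ m) :* A) ≈-refl

  niceEval-lowerBound : ∀ {s A m} → 0# < A → 0# ≤ m → ∀ bs → s * leading bs ≈ A →
                        All (λ b → 0# ≤ m * A + s * b) bs →
                        ∀ {x y} → 1# + m ≤ x → 1# + m ≤ y → A ≤ s * niceEval bs x y
  niceEval-lowerBound {s} 0<A _ [] s*0≈A _ _ _ =
    ⊥-elim (irrefl (≈-trans (≈-sym (zeroʳ s)) s*0≈A) 0<A)
  niceEval-lowerBound {s} 0<A 0≤m (b ∷ bs) s*L≈A (b-bound ∷ bounds) {x} {y} 1+m≤x 1+m≤y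
    with compare (leading bs) 0#
  ... | tri≈ _ L≈0 _ = ≤-reflexive (≈-trans (≈-sym s*L≈A)
          (*-congˡ (≈-sym (niceEval-constant (leading≈0⇒AllZero bs L≈0) x y))))
  ... | tri< _ _ _ = niceEval-cons-lowerBound b bs (inj₁ 0<A) 0≤m 1+m≤y b-bound
                       (niceEval-lowerBound 0<A 0≤m bs s*L≈A bounds 1+m≤y 1+m≤x)
  ... | tri> _ _ _ = niceEval-cons-lowerBound b bs (inj₁ 0<A) 0≤m 1+m≤y b-bound
                       (niceEval-lowerBound 0<A 0≤m bs s*L≈A bounds 1+m≤y 1+m≤x)

  niceEval-linearBound : ∀ {s A m w x y a as} → 0# < A → 0# ≤ m → s * leading as ≈ A →
    All (λ b → 0# ≤ m * A + s * b) (a ∷ as) → 1# + (m + m) ≤ w → w ≤ x → w ≤ y →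
    0# < s * niceEval (a ∷ as) x y × A * (1# + w) ≤ (1# + 1#) * (s * niceEval (a ∷ as) x y)
  niceEval-linearBound {s} {A} {m} {w} {x} {y} {a} {as}
    0<A 0≤m s*L≈A (a-bound ∷ bounds) 1+2m≤w w≤x w≤y = 0<P , +-cancelˡ-≤ ((1# + 1#) * (m * A)) (begin
      (1# + 1#) * (m * A) + A * (1# + w)  ≈⟨ regroup m A w ⟩
      (1# + (m + m)) * A + w * A          ≤⟨ +-monoˡ-≤ (w * A) (*-monoʳ-≤ 0≤A 1+2m≤w) ⟩
      w * A + w * A                       ≤⟨ +-mono-≤ wA≤yA wA≤yA ⟩
      y * A + y * A                       ≤⟨ +-mono-≤ yA≤mA+P yA≤mA+P ⟩
      (m * A + P) + (m * A + P)           ≈⟨ double (m * A) P ⟩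
      (1# + 1#) * (m * A) + (1# + 1#) * P ∎)
    where
    P : Carrier
    P = s * niceEval (a ∷ as) x y
    0≤A : 0# ≤ A
    0≤A = inj₁ 0<A
    1+m≤w : 1# + m ≤ w
    1+m≤w = ≤-trans (+-monoʳ-≤ 1# (x≤x+y 0≤m)) 1+2m≤w
    1+m≤y : 1# + m ≤ y
    1+m≤y = ≤-trans 1+m≤w w≤y
    0≤y : 0# ≤ y
    0≤y = ≤-trans (0≤1+x 0≤m) 1+m≤y
    A≤s*q : A ≤ s * niceEval as y x
    A≤s*q = niceEval-lowerBound 0<A 0≤m as s*L≈A bounds 1+m≤y (≤-trans 1+m≤w w≤x)
    0<P : 0# < P
    0<P = begin-strict
      0#  <⟨ 0<A ⟩
      A   ≤⟨ niceEval-cons-lowerBound a as 0≤A 0≤m 1+m≤y a-bound A≤s*q ⟩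
      P   ∎
    wA≤yA : w * A ≤ y * A
    wA≤yA = *-monoʳ-≤ 0≤A w≤y
    yA≤mA+P : y * A ≤ m * A + P
    yA≤mA+P = niceEval-cons-linearBound a as 0≤y a-bound A≤s*q
    regroup : ∀ m A w → (1# + 1#) * (m * A) + A * (1# + w) ≈ (1# + (m + m)) * A + w * A
    regroup = solve 3 (λ m A w → (con 1 :+ con 1) :* (m :* A) :+ A :* (con 1 :+ w)
                               := (con 1 :+ (m :+ m)) :* A :+ w :* A) ≈-refl
    double : ∀ u v → (u + v) + (u + v) ≈ (1# + 1#) * u + (1# + 1#) * v
    double = solve 2 (λ u v → (u :+ v) :+ (u :+ v)
                             := (con 1 :+ con 1) :* u :+ (con 1 :+ con 1) :* v) ≈-refl

  SignedHalfBound : Carrier → Carrier → Carrier → Set (ℓ ⊔ r)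
  SignedHalfBound a N v = sign v ≡ sign a × ∣ a ∣ * N ≤ (1# + 1#) * ∣ v ∣

  niceEval-signedHalfBound : ∀ {s m w x y a as} → IsSignOf s (leading as) → 0# ≤ m →
    All (λ b → 0# ≤ m * (s * leading as) + s * b) (a ∷ as) → 1# + (m + m) ≤ w → w ≤ x → w ≤ y →
    SignedHalfBound (leading as) (1# + w) (niceEval (a ∷ as) x y)
  niceEval-signedHalfBound {s} {m} {w} {x} {y} {a} {as} sL 0≤m bounds 1+2m≤w w≤x w≤y
    with niceEval-linearBound (IsSignOf⇒0<s*x sL) 0≤m ≈-refl bounds 1+2m≤w w≤x w≤y
  ... | 0<s*P , halfBound = IsSignOf-sign sL 0<s*P , (begin
    ∣ leading as ∣ * (1# + w)      ≈⟨ *-congʳ (IsSignOf-∣∣ sL) ⟩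
    s * leading as * (1# + w)      ≤⟨ halfBound ⟩
    (1# + 1#) * (s * P)            ≈⟨ *-congˡ (IsSignOf-∣∣ (IsSignOf-transfer sL 0<s*P)) ⟨
    (1# + 1#) * ∣ P ∣              ∎)
    where
    P : Carrier
    P = niceEval (a ∷ as) x y

  eval-[] : ∀ k x y → eval F k [] x y ≈ 0#
  eval-[] k x y = eval-elim (_≈ 0#) k [] ≈-refl ≈-refl

  eval-constant : ∀ k {a as} → AllZero as → ∀ x y → eval F k (a ∷ as) x y ≈ a
  eval-constant k {a} {as} as-allZero x y =
    eval-elim (_≈ a) k (a ∷ as)
      (niceEval-constant as-allZero x y) (niceEval-constant as-allZero y x)

  eventually-signedHalfBound : ∀ k a as {s} → IsSignOf s (leading as) →
    let L = leading as
        p = eval F k (a ∷ as)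
    in ∃ λ n₀ → ∀ n → n ≥ n₀ →
         (sign (p (fromℕ n - 1#) (fromℕ n)) ≡ sign L × sign (p (fromℕ n + 1#) (fromℕ n)) ≡ sign L)
         × (∣ L ∣ * fromℕ n ≤ (1# + 1#) * ∣ p (fromℕ n - 1#) (fromℕ n) ∣
            × ∣ L ∣ * fromℕ n ≤ (1# + 1#) * ∣ p (fromℕ n + 1#) (fromℕ n) ∣)
  eventually-signedHalfBound k a as {s} sL
    with archimedean-lowerBound-All (IsSignOf⇒0<s*x sL) (map (s *_) (a ∷ as))
  ... | M , bounds = suc (suc (M ℕ.+ M)) , λ where
        (suc n) (s≤s 1+2M≤n) →
          let sign₋ , bound₋ = atPoint n 1+2M≤n (≤-reflexive (≈-sym (xyx⁻¹≈y 1# (fromℕ n)))) w≤1+w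
              sign₊ , bound₊ = atPoint n 1+2M≤n (≤-trans w≤1+w (x≤x+y (inj₁ 0<1))) w≤1+w
          in (sign₋ , sign₊) , (bound₋ , bound₊)
    where
    w≤1+w : ∀ {w} → w ≤ 1# + w
    w≤1+w = x≤y+x (inj₁ 0<1)
    atPoint : ∀ n → suc (M ℕ.+ M) ℕ.≤ n → ∀ {x y} → fromℕ n ≤ x → fromℕ n ≤ y →
              SignedHalfBound (leading as) (1# + fromℕ n) (eval F k (a ∷ as) x y)
    atPoint n 1+2M≤n w≤x w≤y =
      eval-elim (SignedHalfBound (leading as) (1# + fromℕ n)) k (a ∷ as)
        (niceEval-signedHalfBound sL (0≤fromℕ M) (map⁻ bounds) 1+2m≤w w≤x w≤y)
        (niceEval-signedHalfBound sL (0≤fromℕ M) (map⁻ bounds) 1+2m≤w w≤y w≤x)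
      where
      1+2m≤w : 1# + (fromℕ M + fromℕ M) ≤ fromℕ n
      1+2m≤w = ≤-trans (≤-reflexive (+-congˡ (≈-sym (fromℕ-+ M M)))) (fromℕ-mono-≤ 1+2M≤n)

lemma5p2 : ∀ {c ℓ r} (F : ArchimedeanOrderedField c ℓ r) (k : Kind)
    (as : List (ArchimedeanOrderedField.Carrier F)) →
    let open ArchimedeanOrderedField F
        a = leading as
        p = eval F k as
    in (IsConstant as × (∀ (m n : ℕ) → p (fromℕ m) (fromℕ n) ≈ a))
    ⊎ (∃ λ (n₀ : ℕ) → ∀ (n : ℕ) → n ≥ n₀ →
    ((sign (p (fromℕ n - 1#) (fromℕ n)) ≡ sign a)
    × (sign (p (fromℕ n + 1#) (fromℕ n)) ≡ sign a))
    × ((∣ a ∣ * fromℕ n ≤ (1# + 1#) * ∣ p (fromℕ n - 1#) (fromℕ n) ∣)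
    × (∣ a ∣ * fromℕ n ≤ (1# + 1#) * ∣ p (fromℕ n + 1#) (fromℕ n) ∣)))
lemma5p2 F k [] = inj₁ (lift tt , λ _ _ → eval-[] F k _ _)
lemma5p2 F k (a ∷ as) with compare (leading as) 0#
  where open ArchimedeanOrderedField F
... | tri≈ _ L≈0 _ = let as-allZero = leading≈0⇒AllZero F as L≈0
                     in inj₁ (as-allZero , λ _ _ → eval-constant F k as-allZero _ _)
... | tri< L<0 _ _ = inj₂ (eventually-signedHalfBound F k a as (negative L<0))
... | tri> _ _ 0<L = inj₂ (eventually-signedHalfBound F k a as (positive 0<L))
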